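{- Let $f,g_1,g_2$ be systems, $\sigma_1$ an implementation of $g_1$ in $f$ and $\sigma_2$ an implementation of $g_2$ in $f$. Let $C\subseteq\mathrm{Beh}(f)$ and let $R,S\subseteq\mathrm{Beh}(f)^2$ be $C$-entangled over $(\sigma_1,\sigma_2)$. Then for every system $h$ with $\mathrm{Beh}(h)\neq\emptyset$ and every implementation $\sigma$ of $f$ in $h$, $\sigma$ violates at least one of the following: (1) $C$-consistency; (2) strong $R$-availability together with weak $S$-availability (i.e. it fails at least one of these two); (3) $(\sigma_1,\sigma_2)$-partition-tolerance.
   Context: Fix a collection $\mathbb{C}$ of basic components with behaviour sets $\mathrm{Beh}(c)$; for nonempty $C'\subseteq\mathbb{C}$, $\mathrm{Beh}(C')=\prod_{c\in C'}\mathrm{Beh}(c)$. A system is a function $f:B\to\mathrm{Beh}(C')$, with $\mathrm{Beh}(f):=B$, $\mathrm{Comp}(f):=C'$, and $f_D$ the composite with projection to $\mathrm{Beh}(D)$. An implementation of $g$ in $f$ (with $\mathrm{Comp}(g)\subseteq\mathrm{Comp}(f)$) is $\sigma:\mathrm{Beh}(f)\to\mathrm{Beh}(g)$ with $f_{\mathrm{Comp}(g)}=g\circ\sigma$; it realizes $y$ if $y=\sigma(x)$ for some $x$. An implementation guarantee for $f$ is a set $\mathcal{X}\subseteq\mathcal{P}(\mathrm{Beh}(f))$; an implementation $\sigma$ of $f$ in $h$ satisfies $\mathcal{X}$ if $\{\sigma(x)\mid x\in\mathrm{Beh}(h)\}\in\mathcal{X}$. For $R\subseteq\mathrm{Beh}(f)^2$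 write $R(x,\bullet)=\{y\mid xRy\}$ and $\mathrm{dom}(R)=\{x\mid R(x,\bullet)\neq\emptyset\}$. Guarantees: $C$-consistency is $\{X\mid X\subseteq C\}$; weak $R$-availability is $\{X\mid\forall x\in X\,(x\in\mathrm{dom}(R)\Rightarrow\exists y\in X\cap R(x,\bullet))\}$; strong $R$-availability is $\{X\mid\forall x\in X\, R(x,\bullet)\subseteq X\}$; $(\sigma_1,\sigma_2)$-partition-tolerance is $\{X\subseteq\mathrm{Beh}(f)\mid\forall x_1,x_2\in X\,\exists x\in X:\sigma_1(x)=\sigma_1(x_1),\ \sigma_2(x)=\sigma_2(x_2)\}$. Relations $R,S\subseteq\mathrm{Beh}(f)^2$ are $C$-entangled over $(\sigma_1,\sigma_2)$ if for every $w\in\mathrm{Beh}(f)$ there is $x\in R(w,\bullet)\cap\mathrm{dom}(S)$ such that for all $v\in S(x,\bullet)$ and all $y,z\in\mathrm{Beh}(f)$: if $\sigma_1(y)=\sigma_1(z)=\sigma_1(v)$, $\sigma_2(y)=\sigma_2(w)$ and $\sigma_2(z)=\sigma_2(x)$, then $y\notin C$ or $z\notin C$. -}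

module Defs where

open import Data.Bool using (Bool; T)
open import Data.Product using (Σ; ∃; _×_; _,_; proj₁)
open import Relation.Binary.PropositionalEquality using (_≡_)
open import Relation.Nullary using (¬_)

module Components (𝕮 : Set) (BehC : 𝕮 → Set) where

  -- Subsets of components are decidable (Bool-valued) so membership proofs are unique.
  CompSet : Set
  CompSet = 𝕮 → Bool

  NonEmpty : CompSet → Set
  NonEmpty C' = Σ 𝕮 λ c → T (C' c)

  BehS : CompSet → Set
  BehS C' = (c : 𝕮) → T (C' c) → BehC c

  record System : Set₁ where
    field
      Beh      : Set
      Comp     : CompSet
      nonempty : NonEmpty Comp
      run      : Beh → BehS Comp
  open System public

  _⊆C_ : CompSet → CompSet → Set
  D ⊆C E = (c : 𝕮) → T (D c) → T (E c)

  restrict : (f : System) (D : CompSet) → D ⊆C Comp f → Beh f → BehS D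
  restrict f D incl x c p = run f x c (incl c p)

  IsImpl : (g f : System) → Comp g ⊆C Comp f → (Beh f → Beh g) → Set
  IsImpl g f incl σ =
    (x : Beh f) (c : 𝕮) (p : T (Comp g c)) → restrict f (Comp g) incl x c p ≡ run g (σ x) c p

  record Impl (g f : System) : Set where
    field
      incl   : Comp g ⊆C Comp f
      map    : Beh f → Beh g
      isImpl : IsImpl g f incl map
  open Impl public

  -- subsets of Beh(f) as predicates; implementation guarantees are sets of such
  Guarantee : System → Set₁
  Guarantee f = (Beh f → Set) → Set

  Image : {f h : System} → Impl f h → Beh f → Set
  Image σ y = ∃ λ x → map σ x ≡ y

  Satisfies : {f h : System} → Impl f h → Guarantee f → Set
  Satisfies σ 𝒳 = 𝒳 (Image σ)

  Rel : System → Set₁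
  Rel f = Beh f → Beh f → Set

  dom : {f : System} → Rel f → Beh f → Set
  dom R x = ∃ λ y → R x y

  Consistency : (f : System) → (Beh f → Set) → Guarantee f
  Consistency f C X = ∀ x → X x → C x

  WeakAvail : (f : System) → Rel f → Guarantee f
  WeakAvail f R X = ∀ x → X x → dom {f} R x → ∃ λ y → X y × R x y

  StrongAvail : (f : System) → Rel f → Guarantee f
  StrongAvail f R X = ∀ x → X x → ∀ y → R x y → X y

  PartitionTolerance : (f : System) {g₁ g₂ : System} →
                       Impl g₁ f → Impl g₂ f → Guarantee f
  PartitionTolerance f σ₁ σ₂ X =
    ∀ x₁ x₂ → X x₁ → X x₂ →
      ∃ λ x → X x × map σ₁ x ≡ map σ₁ x₁ × map σ₂ x ≡ map σ₂ x₂

  Entangled : (f : System) {g₁ g₂ : System} → (Beh f → Set) → Rel f → Rel f →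
              Impl g₁ f → Impl g₂ f → Set
  Entangled f C R S σ₁ σ₂ =
    ∀ w → ∃ λ x → R w x × dom {f} S x ×
      (∀ v → S x v → ∀ y z →
         map σ₁ y ≡ map σ₁ v → map σ₁ z ≡ map σ₁ v →
         map σ₂ y ≡ map σ₂ w → map σ₂ z ≡ map σ₂ x →
         ¬ (C y × C z))

-- The guarantees only constrain the image X of σ, which is nonempty. Pick w ∈ X and its
-- entangled R-successor x; strong R-availability puts x in X, weak S-availability gives
-- v ∈ X ∩ S(x,•), and partition tolerance glues σ₁(v) with σ₂(w) and with σ₂(x) into
-- y, z ∈ X. Consistency puts both in C, which entanglement forbids.

module Submission where

open import Defs
open import Data.Product using (_×_; _,_)
open import Relation.Binary.PropositionalEquality using (refl)
open import Relation.Nullary using (¬_)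

module _ (𝕮 : Set) (BehC : 𝕮 → Set) where
  open Components 𝕮 BehC

  entangled⇒¬guarantees : (f : System) {g₁ g₂ : System} (σ₁ : Impl g₁ f) (σ₂ : Impl g₂ f)
    (C : Beh f → Set) (R S : Rel f) → Entangled f C R S σ₁ σ₂ →
    (X : Beh f → Set) (w : Beh f) → X w →
    ¬ ( Consistency f C X
      × (StrongAvail f R X × WeakAvail f S X)
      × PartitionTolerance f σ₁ σ₂ X )
  entangled⇒¬guarantees f σ₁ σ₂ C R S entangled X w w∈X (consistent , (strong , weak) , tolerant)
    with entangled w
  ... | x , Rwx , x∈domS , separated
    with strong w w∈X x Rwx
  ... | x∈X
    with weak x x∈X x∈domS
  ... | v , v∈X , Sxv
    with tolerant v w v∈X w∈X | tolerant v x v∈X x∈X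
  ... | y , y∈X , σ₁y≡σ₁v , σ₂y≡σ₂w | z , z∈X , σ₁z≡σ₁v , σ₂z≡σ₂x =
    separated v Sxv y z σ₁y≡σ₁v σ₁z≡σ₁v σ₂y≡σ₂w σ₂z≡σ₂x (consistent y y∈X , consistent z z∈X)

theorem1 : (𝕮 : Set) (BehC : 𝕮 → Set) →
    let open Components 𝕮 BehC in
    (f g₁ g₂ : System) (σ₁ : Impl g₁ f) (σ₂ : Impl g₂ f)
    (C : Beh f → Set) (R S : Rel f) →
    Entangled f C R S σ₁ σ₂ →
    (h : System) → Beh h → (σ : Impl f h) →
    ¬ ( Satisfies σ (Consistency f C)
    × (Satisfies σ (StrongAvail f R) × Satisfies σ (WeakAvail f S))
    × Satisfies σ (PartitionTolerance f σ₁ σ₂) )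
theorem1 𝕮 BehC f g₁ g₂ σ₁ σ₂ C R S entangled h b σ =
  entangled⇒¬guarantees 𝕮 BehC f σ₁ σ₂ C R S entangled
    (Image σ) (map σ b) (b , refl)
  where open Components 𝕮 BehC
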